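{- For all integers $n,m\ge0$, \[ \mathcal{C}_{n,m}^{(k)}(a,q,L)=\frac{(a+m)^k}{l^{m}a^{k}}\sum_{j=0}^{m}\left\{ {m+n \atop j+n} \right\}_{n} q^{m-j}\,c_{n+j}^{(k)}(a,q,L), \] and $\mathcal{C}_{n,0}^{(k)}(a,q,L)=c_n^{(k)}(a,q,L)$.
   Context: Let $k\ge1$ be an integer, let $a,q,l_1,\dots,l_k$ be nonzero reals, $L=(l_1,\dots,l_k)$, $l=\prod_{i=1}^k l_i$; denominators $a+j$ ($j\ge0$ integer) are assumed nonzero and $l^{a+i}$ means $l^a l^i$. Let $s(n,i)$ be the signed Stirling numbers of the first kind ($\frac{1}{i!}(\ln(1+x))^i=\sum_{n\ge i}s(n,i)\frac{x^n}{n!}$). The generalized poly-Cauchy numbers of the first kind are $c_n^{(k)}(a,q,L)=\sum_{i=0}^n s(n,i)\frac{q^{n-i}l^{a+i}}{(a+i)^k}$, and the generalized $m$-poly-Cauchy numbers of the first kind are \[ \mathcal{C}_{n,m}^{(k)}(a,q,L)=\frac{(a+m)^k}{a^k}\sum_{i=0}^{n}s(n,i)\frac{q^{n-i}l^{a+i}}{(a+i+m)^k}. \] The $r$-Stirling numbers of the second kind $\left\{ {n \atop i} \right\}_r$ are defined by $\sum_{n\ge i}\left\{ {n+r \atop i+r} \right\}_r\frac{z^n}{n!}=\frac{1}{i!}e^{rz}(e^z-1)^i$ for integers $r,i\ge0$. -}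

module Defs where

open import Level using (_⊔_)
open import Data.Nat as ℕ using (ℕ; zero; suc; _∸_)
open import Data.Integer as ℤ using (ℤ; +_; -[1+_])
open import Data.Vec using (Vec; []; _∷_)
open import Algebra.Bundles using (CommutativeRing)
open import Relation.Nullary using (¬_)

-- Signed Stirling numbers of the first kind s(n,i), from the generating
-- function (1/i!) (ln(1+x))^i = Σ_n s(n,i) x^n/n!, equivalently
-- s(0,0)=1, s(0,i+1)=0, s(n+1,0)=0, s(n+1,i+1) = s(n,i) - n s(n,i+1).
stirling1 : ℕ → ℕ → ℤ
stirling1 zero    zero    = + 1
stirling1 zero    (suc i) = + 0
stirling1 (suc n) zero    = + 0
stirling1 (suc n) (suc i) = stirling1 n i ℤ.- (+ n) ℤ.* stirling1 n (suc i)

-- rStirling2 r n i = { n+r \atop i+r }_r, the r-Stirling numbers of the second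
-- kind, i.e. n! [z^n] of (1/i!) e^{rz} (e^z-1)^i.  Writing F_i for that
-- generating function, F_i' = (i+r) F_i + F_{i-1}, F_i(0) = δ_{i0}, hence:
rStirling2 : ℕ → ℕ → ℕ → ℕ
rStirling2 r zero    zero    = 1
rStirling2 r zero    (suc i) = 0
rStirling2 r (suc n) zero    = r ℕ.* rStirling2 r n zero
rStirling2 r (suc n) (suc i) = (suc i ℕ.+ r) ℕ.* rStirling2 r n (suc i) ℕ.+ rStirling2 r n i

-- A field: a commutative ring with 0 ≉ 1 and a total inversion map which is
-- a two-sided inverse on nonzero elements (x ⁻¹ is unspecified for x ≈ 0).
record Field (c ℓ : Level.Level) : Set (Level.suc (c ⊔ ℓ)) where
  field
    commutativeRing : CommutativeRing c ℓ
  open CommutativeRing commutativeRing public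
  field
    _⁻¹     : Carrier → Carrier
    0≉1     : ¬ (0# ≈ 1#)
    inverse : ∀ x → ¬ (x ≈ 0#) → x * (x ⁻¹) ≈ 1#

module FieldOps {c ℓ} (F : Field c ℓ) where
  open Field F public

  infixl 7 _/_
  _/_ : Carrier → Carrier → Carrier
  x / y = x * (y ⁻¹)

  nat : ℕ → Carrier
  nat zero    = 0#
  nat (suc n) = 1# + nat n

  int : ℤ → Carrier
  int (+ n)     = nat n
  int -[1+ n ]  = - nat (suc n)

  pow : Carrier → ℕ → Carrier
  pow x zero    = 1#
  pow x (suc n) = x * pow x n

  sumTo : ℕ → (ℕ → Carrier) → Carrier
  sumTo zero    f = f 0
  sumTo (suc n) f = sumTo n f + f (suc n)

  prodVec : ∀ {k} → Vec Carrier k → Carrier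
  prodVec []       = 1#
  prodVec (x ∷ xs) = x * prodVec xs

  -- Parameters: k, a, q, L = (l_1,…,l_k), and la = l^a (so l^{a+i} = la · l^i).
  -- Generalized poly-Cauchy numbers of the first kind c_n^{(k)}(a,q,L).
  polyCauchy : (k : ℕ) (a q : Carrier) (L : Vec Carrier k) (la : Carrier) → ℕ → Carrier
  polyCauchy k a q L la n =
    sumTo n (λ i → int (stirling1 n i) * pow q (n ∸ i) * (la * pow (prodVec L) i)
                     / pow (a + nat i) k)

  mPolyCauchy : (k : ℕ) (a q : Carrier) (L : Vec Carrier k) (la : Carrier) → ℕ → ℕ → Carrier
  mPolyCauchy k a q L la n m =
    pow (a + nat m) k / pow a k *
    sumTo n (λ i → int (stirling1 n i) * pow q (n ∸ i) * (la * pow (prodVec L) i)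
                     / pow (a + nat (i ℕ.+ m)) k)

-- Expanding each c_{n+j} makes the right-hand sum linear in the weights w(i) = l^{a+i}/(a+i)^k.
-- After exchanging the two sums, the coefficient of q^{n+m-i} w(i) is the convolution
-- Σ_j {m+n, j+n}_n s(n+j, i) of r-Stirling numbers of the second kind with Stirling
-- numbers of the first kind, and comparing the two triangular recurrences shows that it
-- equals s(n, i-m) (and 0 for i < m).  Since w(m+i) = l^m l^{a+i}/(a+i+m)^k, what
-- survives is l^m a^k/(a+m)^k times C_{n,m}.
module Submission where

open import Defs
open import Data.Nat as ℕ using (ℕ; zero; suc; _≤_; _<_; z≤n; s≤s)
import Data.Nat.Properties as ℕP
open import Data.Integer as ℤ using (ℤ; +_; -[1+_])
import Data.Integer.Properties as ℤP
open import Data.Sum using (inj₁; inj₂)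
open import Data.Fin as Fin using (Fin)
open import Data.Vec using (Vec; []; _∷_; lookup)
open import Data.Product using (_×_; _,_)
open import Relation.Binary.PropositionalEquality as ≡ using (_≡_)
open import Relation.Nullary using (¬_)
import Algebra.Properties.CommutativeSemigroup as CommutativeSemigroupProperties
import Algebra.Properties.Ring as RingProperties

stirling1-vanish : ∀ {n i} → n < i → stirling1 n i ≡ + 0
stirling1-vanish {zero}  {suc i} _ = ≡.refl
stirling1-vanish {suc n} {suc i} (s≤s n<i)
  rewrite stirling1-vanish n<i | stirling1-vanish (ℕP.m<n⇒m<1+n n<i) | ℤP.*-zeroʳ (+ n) = ≡.refl

rStirling2-vanish : ∀ r {m j} → m < j → rStirling2 r m j ≡ 0
rStirling2-vanish r {zero}  {suc j} _ = ≡.refl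
rStirling2-vanish r {suc m} {suc j} (s≤s m<j)
  rewrite rStirling2-vanish r (ℕP.m<n⇒m<1+n m<j) | rStirling2-vanish r m<j
        | ℕP.*-zeroʳ (suc j ℕ.+ r) = ≡.refl

m∸n+n∸o≡m∸o : ∀ {m n o} → n ≤ m → o ≤ n → (m ℕ.∸ n) ℕ.+ (n ℕ.∸ o) ≡ m ℕ.∸ o
m∸n+n∸o≡m∸o {m} {n} {o} n≤m o≤n =
  ≡.trans (≡.sym (ℕP.+-∸-assoc (m ℕ.∸ n) o≤n)) (≡.cong (ℕ._∸ o) (ℕP.m∸n+n≡m n≤m))

module FieldProperties {c ℓ} (F : Field c ℓ) where
  open FieldOps F
  open RingProperties ring using (-0#≈0#; -‿involutive; -‿+-comm; -‿distribʳ-*; xyx⁻¹≈y)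
  module Additive = CommutativeSemigroupProperties +-commutativeSemigroup
  module Multiplicative = CommutativeSemigroupProperties *-commutativeSemigroup
  open import Relation.Binary.Reasoning.Setoid setoid

  nat-+ : ∀ m n → nat (m ℕ.+ n) ≈ nat m + nat n
  nat-+ zero    n = sym (+-identityˡ _)
  nat-+ (suc m) n = trans (+-congˡ (nat-+ m n)) (sym (+-assoc 1# (nat m) (nat n)))

  nat-* : ∀ m n → nat (m ℕ.* n) ≈ nat m * nat n
  nat-* zero    n = sym (zeroˡ _)
  nat-* (suc m) n = begin
    nat (n ℕ.+ m ℕ.* n)          ≈⟨ nat-+ n (m ℕ.* n) ⟩
    nat n + nat (m ℕ.* n)        ≈⟨ +-cong (sym (*-identityˡ _)) (nat-* m n) ⟩
    1# * nat n + nat m * nat n   ≈⟨ distribʳ (nat n) 1# (nat m) ⟨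
    nat (suc m) * nat n          ∎

  pow-+ : ∀ x m n → pow x (m ℕ.+ n) ≈ pow x m * pow x n
  pow-+ x zero    n = sym (*-identityˡ _)
  pow-+ x (suc m) n = trans (*-congˡ (pow-+ x m n)) (sym (*-assoc _ _ _))

  pow-congˡ : ∀ n {x y} → x ≈ y → pow x n ≈ pow y n
  pow-congˡ zero    _   = refl
  pow-congˡ (suc n) x≈y = *-cong x≈y (pow-congˡ n x≈y)

  int-neg : ∀ x → int (ℤ.- x) ≈ - int x
  int-neg (+ zero)  = sym -0#≈0#
  int-neg (+ suc n) = refl
  int-neg -[1+ n ]  = sym (-‿involutive _)

  int-⊖ : ∀ m n → int (m ℤ.⊖ n) ≈ nat m - nat n
  int-⊖ m zero = begin
    int (m ℤ.⊖ 0)  ≡⟨ ≡.cong int (ℤP.⊖-≥ {m} {0} z≤n) ⟩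
    nat m          ≈⟨ +-identityʳ (nat m) ⟨
    nat m + 0#     ≈⟨ +-congˡ -0#≈0# ⟨
    nat m - nat 0  ∎
  int-⊖ zero (suc n) = begin
    int (0 ℤ.⊖ suc n)  ≡⟨ ≡.cong int (ℤP.⊖-< {0} {suc n} (s≤s z≤n)) ⟩
    - nat (suc n)      ≈⟨ +-identityˡ _ ⟨
    0# - nat (suc n)   ∎
  int-⊖ (suc m) (suc n) = begin
    int (suc m ℤ.⊖ suc n)            ≡⟨ ≡.cong int (ℤP.[1+m]⊖[1+n]≡m⊖n m n) ⟩
    int (m ℤ.⊖ n)                    ≈⟨ int-⊖ m n ⟩
    nat m - nat n                    ≈⟨ +-identityˡ _ ⟨
    0# + (nat m - nat n)             ≈⟨ +-congʳ (-‿inverseʳ 1#) ⟨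
    (1# - 1#) + (nat m - nat n)      ≈⟨ Additive.interchange 1# (- 1#) (nat m) (- nat n) ⟩
    (1# + nat m) + (- 1# - nat n)    ≈⟨ +-congˡ (-‿+-comm 1# (nat n)) ⟩
    nat (suc m) - nat (suc n)        ∎

  int-+ : ∀ x y → int (x ℤ.+ y) ≈ int x + int y
  int-+ (+ m)    (+ n)    = nat-+ m n
  int-+ (+ m)    -[1+ n ] = int-⊖ m (suc n)
  int-+ -[1+ m ] (+ n)    = trans (int-⊖ n (suc m)) (+-comm _ _)
  int-+ -[1+ m ] -[1+ n ] = begin
    - (1# + nat (suc (m ℕ.+ n)))      ≈⟨ -‿cong (+-congˡ (nat-+ (suc m) n)) ⟩
    - (1# + (nat (suc m) + nat n))    ≈⟨ -‿cong (Additive.x∙yz≈y∙xz 1# (nat (suc m)) (nat n)) ⟩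
    - (nat (suc m) + nat (suc n))     ≈⟨ -‿+-comm _ _ ⟨
    - nat (suc m) + - nat (suc n)     ∎

  int-*ˡ : ∀ m y → int (+ m ℤ.* y) ≈ nat m * int y
  int-*ˡ m (+ n) = trans (reflexive (≡.cong int (ℤP.+◃n≡+n (m ℕ.* n)))) (nat-* m n)
  int-*ˡ m -[1+ n ] = begin
    int (+ m ℤ.* -[1+ n ])       ≡⟨ ≡.cong int (ℤP.-◃n≡-n (m ℕ.* suc n)) ⟩
    int (ℤ.- + (m ℕ.* suc n))    ≈⟨ int-neg (+ (m ℕ.* suc n)) ⟩
    - nat (m ℕ.* suc n)          ≈⟨ -‿cong (nat-* m (suc n)) ⟩
    - (nat m * nat (suc n))      ≈⟨ -‿distribʳ-* _ _ ⟩
    nat m * - nat (suc n)        ∎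

  nat*stirling1-zero : ∀ N → nat N * int (stirling1 N 0) ≈ 0#
  nat*stirling1-zero zero    = zeroˡ _
  nat*stirling1-zero (suc N) = zeroʳ _

  nat*stirling1+stirling1-suc : ∀ N i →
    nat N * int (stirling1 N (suc i)) + int (stirling1 (suc N) (suc i)) ≈ int (stirling1 N i)
  nat*stirling1+stirling1-suc N i = begin
    x + int (stirling1 (suc N) (suc i))
      ≈⟨ +-congˡ (int-+ (stirling1 N i) _) ⟩
    x + (int (stirling1 N i) + int (ℤ.- (+ N ℤ.* stirling1 N (suc i))))
      ≈⟨ +-congˡ (+-congˡ (trans (int-neg (+ N ℤ.* stirling1 N (suc i))) (-‿cong (int-*ˡ N (stirling1 N (suc i)))))) ⟩
    x + (int (stirling1 N i) - x)
      ≈⟨ +-assoc _ _ _ ⟨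
    x + int (stirling1 N i) - x
      ≈⟨ xyx⁻¹≈y _ _ ⟩
    int (stirling1 N i) ∎
    where x = nat N * int (stirling1 N (suc i))

  sumTo-cong : ∀ n {f g : ℕ → Carrier} → (∀ i → i ≤ n → f i ≈ g i) → sumTo n f ≈ sumTo n g
  sumTo-cong zero    f≈g = f≈g 0 z≤n
  sumTo-cong (suc n) f≈g =
    +-cong (sumTo-cong n (λ i i≤n → f≈g i (ℕP.m≤n⇒m≤1+n i≤n))) (f≈g (suc n) ℕP.≤-refl)

  sumTo-zero : ∀ n {f : ℕ → Carrier} → (∀ i → i ≤ n → f i ≈ 0#) → sumTo n f ≈ 0#
  sumTo-zero zero    f≈0 = f≈0 0 z≤n
  sumTo-zero (suc n) f≈0 =
    trans (+-cong (sumTo-zero n (λ i i≤n → f≈0 i (ℕP.m≤n⇒m≤1+n i≤n))) (f≈0 (suc n) ℕP.≤-refl))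
          (+-identityʳ 0#)

  sumTo-+ : ∀ n (f g : ℕ → Carrier) → sumTo n (λ i → f i + g i) ≈ sumTo n f + sumTo n g
  sumTo-+ zero    f g = refl
  sumTo-+ (suc n) f g = trans (+-congʳ (sumTo-+ n f g)) (Additive.interchange _ _ _ _)

  sumTo-*ˡ : ∀ n x (f : ℕ → Carrier) → sumTo n (λ i → x * f i) ≈ x * sumTo n f
  sumTo-*ˡ zero    x f = refl
  sumTo-*ˡ (suc n) x f = trans (+-congʳ (sumTo-*ˡ n x f)) (sym (distribˡ x _ _))

  sumTo-*ʳ : ∀ n x (f : ℕ → Carrier) → sumTo n (λ i → f i * x) ≈ sumTo n f * x
  sumTo-*ʳ zero    x f = refl
  sumTo-*ʳ (suc n) x f = trans (+-congʳ (sumTo-*ʳ n x f)) (sym (distribʳ x _ _))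

  sumTo-sucˡ : ∀ n (f : ℕ → Carrier) → sumTo (suc n) f ≈ f 0 + sumTo n (λ i → f (suc i))
  sumTo-sucˡ zero    f = refl
  sumTo-sucˡ (suc n) f = trans (+-congʳ (sumTo-sucˡ n f)) (+-assoc _ _ _)

  sumTo-comm : ∀ m n (f : ℕ → ℕ → Carrier) →
    sumTo m (λ j → sumTo n (f j)) ≈ sumTo n (λ i → sumTo m (λ j → f j i))
  sumTo-comm zero    n f = refl
  sumTo-comm (suc m) n f =
    trans (+-congʳ (sumTo-comm m n f)) (sym (sumTo-+ n (λ i → sumTo m (λ j → f j i)) (f (suc m))))

  sumTo-pad : ∀ {n M} (f : ℕ → Carrier) → n ≤ M → (∀ {i} → n < i → f i ≈ 0#) →
    sumTo n f ≈ sumTo M f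
  sumTo-pad {M = zero} f z≤n _ = refl
  sumTo-pad {n} {suc M} f n≤1+M f≈0 with ℕP.m≤n⇒m<n∨m≡n n≤1+M
  ... | inj₂ ≡.refl = refl
  ... | inj₁ (s≤s n≤M) = begin
    sumTo n f             ≈⟨ sumTo-pad f n≤M f≈0 ⟩
    sumTo M f             ≈⟨ +-identityʳ _ ⟨
    sumTo M f + 0#        ≈⟨ +-congˡ (f≈0 (s≤s n≤M)) ⟨
    sumTo M f + f (suc M) ∎

  sumTo-drop : ∀ m n (f : ℕ → Carrier) → (∀ i → i < m → f i ≈ 0#) →
    sumTo (m ℕ.+ n) f ≈ sumTo n (λ i → f (m ℕ.+ i))
  sumTo-drop zero    n f _   = refl
  sumTo-drop (suc m) n f f≈0 = begin
    sumTo (suc (m ℕ.+ n)) f                   ≈⟨ sumTo-sucˡ (m ℕ.+ n) f ⟩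
    f 0 + sumTo (m ℕ.+ n) (λ i → f (suc i))   ≈⟨ +-congʳ (f≈0 0 (s≤s z≤n)) ⟩
    0# + sumTo (m ℕ.+ n) (λ i → f (suc i))    ≈⟨ +-identityˡ _ ⟩
    sumTo (m ℕ.+ n) (λ i → f (suc i))         ≈⟨ sumTo-drop m n _ (λ i i<m → f≈0 (suc i) (s≤s i<m)) ⟩
    sumTo n (λ i → f (suc m ℕ.+ i))           ∎

  -- Orthogonality of the Stirling numbers of the two kinds

  sumTo-rStirling2-suc : ∀ r m (x : ℕ → Carrier) →
    sumTo (suc m) (λ j → nat (rStirling2 r (suc m) j) * x j)
      ≈ sumTo m (λ j → nat (rStirling2 r m j) * (nat (j ℕ.+ r) * x j + x (suc j)))
  sumTo-rStirling2-suc r m x = begin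
    sumTo (suc m) (λ j → nat (S′ j) * x j)
      ≈⟨ sumTo-sucˡ m _ ⟩
    nat (S′ 0) * x 0 + sumTo m (λ j → nat (S′ (suc j)) * x (suc j))
      ≈⟨ +-cong first (trans (sumTo-cong m (λ j _ → next j)) (sumTo-+ m _ _)) ⟩
    A 0 + (sumTo m (λ j → A (suc j)) + sumTo m B)
      ≈⟨ +-assoc _ _ _ ⟨
    (A 0 + sumTo m (λ j → A (suc j))) + sumTo m B
      ≈⟨ +-congʳ (sumTo-sucˡ m A) ⟨
    (sumTo m A + A (suc m)) + sumTo m B
      ≈⟨ +-congʳ (+-congˡ (trans (*-congʳ (reflexive (≡.cong nat S-vanish))) (zeroˡ _))) ⟩
    (sumTo m A + 0#) + sumTo m B
      ≈⟨ +-congʳ (+-identityʳ _) ⟩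
    sumTo m A + sumTo m B
      ≈⟨ sumTo-+ m A B ⟨
    sumTo m (λ j → A j + B j)
      ≈⟨ sumTo-cong m (λ j _ → sym (distribˡ _ _ _)) ⟩
    sumTo m (λ j → nat (S j) * (nat (j ℕ.+ r) * x j + x (suc j))) ∎
    where
    S S′ : ℕ → ℕ
    S  = rStirling2 r m
    S′ = rStirling2 r (suc m)
    A B : ℕ → Carrier
    A j = nat (S j) * (nat (j ℕ.+ r) * x j)
    B j = nat (S j) * x (suc j)
    S-vanish : S (suc m) ≡ 0
    S-vanish = rStirling2-vanish r {m} {suc m} ℕP.≤-refl
    first : nat (S′ 0) * x 0 ≈ A 0
    first = trans (*-congʳ (nat-* r (S 0))) (Multiplicative.xy∙z≈y∙xz _ _ _)
    next : ∀ j → nat (S′ (suc j)) * x (suc j) ≈ A (suc j) + B j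
    next j = begin
      nat ((suc j ℕ.+ r) ℕ.* S (suc j) ℕ.+ S j) * x (suc j)
        ≈⟨ *-congʳ (trans (nat-+ ((suc j ℕ.+ r) ℕ.* S (suc j)) (S j)) (+-congʳ (nat-* (suc j ℕ.+ r) (S (suc j))))) ⟩
      (nat (suc j ℕ.+ r) * nat (S (suc j)) + nat (S j)) * x (suc j)
        ≈⟨ distribʳ _ _ _ ⟩
      nat (suc j ℕ.+ r) * nat (S (suc j)) * x (suc j) + B j
        ≈⟨ +-congʳ (Multiplicative.xy∙z≈y∙xz _ _ _) ⟩
      A (suc j) + B j ∎

  rStirlingConvolution : ℕ → ℕ → ℕ → Carrier
  rStirlingConvolution n m i = sumTo m (λ j → nat (rStirling2 n m j) * int (stirling1 (n ℕ.+ j) i))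

  rStirlingConvolution-zero : ∀ n i → rStirlingConvolution n 0 i ≈ int (stirling1 n i)
  rStirlingConvolution-zero n i = begin
    (1# + 0#) * int (stirling1 (n ℕ.+ 0) i)  ≈⟨ *-congʳ (+-identityʳ 1#) ⟩
    1# * int (stirling1 (n ℕ.+ 0) i)         ≈⟨ *-identityˡ _ ⟩
    int (stirling1 (n ℕ.+ 0) i)              ≡⟨ ≡.cong (λ t → int (stirling1 t i)) (ℕP.+-identityʳ n) ⟩
    int (stirling1 n i)                      ∎

  rStirlingConvolution-suc-zero : ∀ n m → rStirlingConvolution n (suc m) 0 ≈ 0#
  rStirlingConvolution-suc-zero n m =
    trans (sumTo-rStirling2-suc n m _) (sumTo-zero m (λ j _ → term j))
    where
    term : ∀ j → nat (rStirling2 n m j)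
                   * (nat (j ℕ.+ n) * int (stirling1 (n ℕ.+ j) 0) + int (stirling1 (n ℕ.+ suc j) 0))
                 ≈ 0#
    term j rewrite ℕP.+-comm j n | ℕP.+-suc n j =
      trans (*-congˡ (trans (+-identityʳ _) (nat*stirling1-zero (n ℕ.+ j)))) (zeroʳ _)

  rStirlingConvolution-suc-suc : ∀ n m i →
    rStirlingConvolution n (suc m) (suc i) ≈ rStirlingConvolution n m i
  rStirlingConvolution-suc-suc n m i =
    trans (sumTo-rStirling2-suc n m _) (sumTo-cong m (λ j _ → term j))
    where
    term : ∀ j → nat (rStirling2 n m j)
                   * (nat (j ℕ.+ n) * int (stirling1 (n ℕ.+ j) (suc i))
                      + int (stirling1 (n ℕ.+ suc j) (suc i)))
                 ≈ nat (rStirling2 n m j) * int (stirling1 (n ℕ.+ j) i)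
    term j rewrite ℕP.+-comm j n | ℕP.+-suc n j = *-congˡ (nat*stirling1+stirling1-suc (n ℕ.+ j) i)

  rStirlingConvolution-below : ∀ n {m i} → i < m → rStirlingConvolution n m i ≈ 0#
  rStirlingConvolution-below n {suc m} {zero}  _         = rStirlingConvolution-suc-zero n m
  rStirlingConvolution-below n {suc m} {suc i} (s≤s i<m) =
    trans (rStirlingConvolution-suc-suc n m i) (rStirlingConvolution-below n i<m)

  rStirlingConvolution-shift : ∀ n m i → rStirlingConvolution n m (m ℕ.+ i) ≈ int (stirling1 n i)
  rStirlingConvolution-shift n zero    i = rStirlingConvolution-zero n i
  rStirlingConvolution-shift n (suc m) i =
    trans (rStirlingConvolution-suc-suc n m (m ℕ.+ i)) (rStirlingConvolution-shift n m i)

  stirlingTransform : Carrier → ℕ → (ℕ → Carrier) → Carrier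
  stirlingTransform q n w = sumTo n (λ i → int (stirling1 n i) * pow q (n ℕ.∸ i) * w i)

  stirlingTransform-cong : ∀ q n {v w : ℕ → Carrier} → (∀ i → v i ≈ w i) →
    stirlingTransform q n v ≈ stirlingTransform q n w
  stirlingTransform-cong q n v≈w = sumTo-cong n (λ i _ → *-congˡ (v≈w i))

  stirlingTransform-*ˡ : ∀ q n x (w : ℕ → Carrier) →
    stirlingTransform q n (λ i → x * w i) ≈ x * stirlingTransform q n w
  stirlingTransform-*ˡ q n x w =
    trans (sumTo-cong n (λ i _ → Multiplicative.x∙yz≈y∙xz _ x _)) (sumTo-*ˡ n x _)

  pow*stirlingTransform : ∀ q {N M} (w : ℕ → Carrier) → N ≤ M →
    pow q (M ℕ.∸ N) * stirlingTransform q N w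
      ≈ sumTo M (λ i → int (stirling1 N i) * (pow q (M ℕ.∸ i) * w i))
  pow*stirlingTransform q {N} {M} w N≤M = begin
    pow q (M ℕ.∸ N) * stirlingTransform q N w
      ≈⟨ sumTo-*ˡ N _ _ ⟨
    sumTo N (λ i → pow q (M ℕ.∸ N) * (int (stirling1 N i) * pow q (N ℕ.∸ i) * w i))
      ≈⟨ sumTo-cong N term ⟩
    sumTo N (λ i → int (stirling1 N i) * (pow q (M ℕ.∸ i) * w i))
      ≈⟨ sumTo-pad _ N≤M (λ N<i → trans (*-congʳ (reflexive (≡.cong int (stirling1-vanish N<i)))) (zeroˡ _)) ⟩
    sumTo M (λ i → int (stirling1 N i) * (pow q (M ℕ.∸ i) * w i)) ∎
    where
    term : ∀ i → i ≤ N → pow q (M ℕ.∸ N) * (int (stirling1 N i) * pow q (N ℕ.∸ i) * w i)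
                          ≈ int (stirling1 N i) * (pow q (M ℕ.∸ i) * w i)
    term i i≤N = begin
      pow q (M ℕ.∸ N) * (s * pow q (N ℕ.∸ i) * w i)    ≈⟨ *-congˡ (*-assoc _ _ _) ⟩
      pow q (M ℕ.∸ N) * (s * (pow q (N ℕ.∸ i) * w i))  ≈⟨ Multiplicative.x∙yz≈y∙xz _ _ _ ⟩
      s * (pow q (M ℕ.∸ N) * (pow q (N ℕ.∸ i) * w i))  ≈⟨ *-congˡ (*-assoc _ _ _) ⟨
      s * (pow q (M ℕ.∸ N) * pow q (N ℕ.∸ i) * w i)    ≈⟨ *-congˡ (*-congʳ (pow-+ q (M ℕ.∸ N) (N ℕ.∸ i))) ⟨
      s * (pow q (M ℕ.∸ N ℕ.+ (N ℕ.∸ i)) * w i)        ≡⟨ ≡.cong (λ e → s * (pow q e * w i)) (m∸n+n∸o≡m∸o N≤M i≤N) ⟩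
      s * (pow q (M ℕ.∸ i) * w i)                      ∎
      where s = int (stirling1 N i)

  stirlingTransform-rStirling2 : ∀ q n m (w : ℕ → Carrier) →
    sumTo m (λ j → nat (rStirling2 n m j) * pow q (m ℕ.∸ j) * stirlingTransform q (n ℕ.+ j) w)
      ≈ stirlingTransform q n (λ i → w (m ℕ.+ i))
  stirlingTransform-rStirling2 q n m w = begin
    sumTo m (λ j → nat (S j) * pow q (m ℕ.∸ j) * stirlingTransform q (n ℕ.+ j) w)
      ≈⟨ sumTo-cong m expand ⟩
    sumTo m (λ j → sumTo (n ℕ.+ m) (λ i → nat (S j) * int (stirling1 (n ℕ.+ j) i) * v i))
      ≈⟨ sumTo-comm m (n ℕ.+ m) _ ⟩
    sumTo (n ℕ.+ m) (λ i → sumTo m (λ j → nat (S j) * int (stirling1 (n ℕ.+ j) i) * v i))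
      ≈⟨ sumTo-cong (n ℕ.+ m) (λ i _ → sumTo-*ʳ m (v i) _) ⟩
    sumTo (n ℕ.+ m) (λ i → rStirlingConvolution n m i * v i)
      ≡⟨ ≡.cong (λ t → sumTo t (λ i → rStirlingConvolution n m i * v i)) (ℕP.+-comm n m) ⟩
    sumTo (m ℕ.+ n) (λ i → rStirlingConvolution n m i * v i)
      ≈⟨ sumTo-drop m n _ (λ i i<m → trans (*-congʳ (rStirlingConvolution-below n i<m)) (zeroˡ _)) ⟩
    sumTo n (λ i → rStirlingConvolution n m (m ℕ.+ i) * v (m ℕ.+ i))
      ≈⟨ sumTo-cong n (λ i _ → collapse i) ⟩
    stirlingTransform q n (λ i → w (m ℕ.+ i)) ∎
    where
    S : ℕ → ℕ
    S = rStirling2 n m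
    v : ℕ → Carrier
    v i = pow q (n ℕ.+ m ℕ.∸ i) * w i
    expand : ∀ j → j ≤ m →
      nat (S j) * pow q (m ℕ.∸ j) * stirlingTransform q (n ℕ.+ j) w
        ≈ sumTo (n ℕ.+ m) (λ i → nat (S j) * int (stirling1 (n ℕ.+ j) i) * v i)
    expand j j≤m = begin
      nat (S j) * pow q (m ℕ.∸ j) * stirlingTransform q (n ℕ.+ j) w
        ≈⟨ *-assoc _ _ _ ⟩
      nat (S j) * (pow q (m ℕ.∸ j) * stirlingTransform q (n ℕ.+ j) w)
        ≡⟨ ≡.cong (λ e → nat (S j) * (pow q e * stirlingTransform q (n ℕ.+ j) w))
                  (≡.sym (ℕP.[m+n]∸[m+o]≡n∸o n m j)) ⟩
      nat (S j) * (pow q (n ℕ.+ m ℕ.∸ (n ℕ.+ j)) * stirlingTransform q (n ℕ.+ j) w)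
        ≈⟨ *-congˡ (pow*stirlingTransform q w (ℕP.+-monoʳ-≤ n j≤m)) ⟩
      nat (S j) * sumTo (n ℕ.+ m) (λ i → int (stirling1 (n ℕ.+ j) i) * v i)
        ≈⟨ sumTo-*ˡ (n ℕ.+ m) _ _ ⟨
      sumTo (n ℕ.+ m) (λ i → nat (S j) * (int (stirling1 (n ℕ.+ j) i) * v i))
        ≈⟨ sumTo-cong (n ℕ.+ m) (λ i _ → sym (*-assoc _ _ _)) ⟩
      sumTo (n ℕ.+ m) (λ i → nat (S j) * int (stirling1 (n ℕ.+ j) i) * v i) ∎
    collapse : ∀ i → rStirlingConvolution n m (m ℕ.+ i) * v (m ℕ.+ i)
                     ≈ int (stirling1 n i) * pow q (n ℕ.∸ i) * w (m ℕ.+ i)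
    collapse i = begin
      rStirlingConvolution n m (m ℕ.+ i) * (pow q (n ℕ.+ m ℕ.∸ (m ℕ.+ i)) * w (m ℕ.+ i))
        ≈⟨ *-congʳ (rStirlingConvolution-shift n m i) ⟩
      int (stirling1 n i) * (pow q (n ℕ.+ m ℕ.∸ (m ℕ.+ i)) * w (m ℕ.+ i))
        ≡⟨ ≡.cong (λ e → int (stirling1 n i) * (pow q e * w (m ℕ.+ i))) exponent ⟩
      int (stirling1 n i) * (pow q (n ℕ.∸ i) * w (m ℕ.+ i))
        ≈⟨ *-assoc _ _ _ ⟨
      int (stirling1 n i) * pow q (n ℕ.∸ i) * w (m ℕ.+ i) ∎
      where
      exponent : n ℕ.+ m ℕ.∸ (m ℕ.+ i) ≡ n ℕ.∸ i
      exponent = ≡.trans (≡.cong (ℕ._∸ (m ℕ.+ i)) (ℕP.+-comm n m)) (ℕP.[m+n]∸[m+o]≡n∸o m n i)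

  x≉0∧y≉0⇒x*y≉0 : ∀ {x y} → ¬ (x ≈ 0#) → ¬ (y ≈ 0#) → ¬ (x * y ≈ 0#)
  x≉0∧y≉0⇒x*y≉0 {x} {y} x≉0 y≉0 xy≈0 = y≉0 (begin
    y                ≈⟨ *-identityˡ y ⟨
    1# * y           ≈⟨ *-congʳ (trans (sym (inverse x x≉0)) (*-comm _ _)) ⟩
    x ⁻¹ * x * y     ≈⟨ *-assoc _ _ _ ⟩
    x ⁻¹ * (x * y)   ≈⟨ *-congˡ xy≈0 ⟩
    x ⁻¹ * 0#        ≈⟨ zeroʳ _ ⟩
    0#               ∎)

  pow≉0 : ∀ {x} → ¬ (x ≈ 0#) → ∀ n → ¬ (pow x n ≈ 0#)
  pow≉0 x≉0 zero    1≈0 = 0≉1 (sym 1≈0)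
  pow≉0 x≉0 (suc n)     = x≉0∧y≉0⇒x*y≉0 x≉0 (pow≉0 x≉0 n)

  prodVec≉0 : ∀ {k} (L : Vec Carrier k) → (∀ i → ¬ (lookup L i ≈ 0#)) → ¬ (prodVec L ≈ 0#)
  prodVec≉0 []       _    1≈0 = 0≉1 (sym 1≈0)
  prodVec≉0 (x ∷ xs) L≉0      = x≉0∧y≉0⇒x*y≉0 (L≉0 Fin.zero) (prodVec≉0 xs (λ i → L≉0 (Fin.suc i)))

  /-*-cancelˡ : ∀ {x y} z w → ¬ (x ≈ 0#) → ¬ (y ≈ 0#) → z / (x * y) * (x * w) ≈ z / y * w
  /-*-cancelˡ {x} {y} z w x≉0 y≉0 = begin
    z * u * (x * w)      ≈⟨ *-assoc _ _ _ ⟩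
    z * (u * (x * w))    ≈⟨ *-congˡ (*-assoc _ _ _) ⟨
    z * (u * x * w)      ≈⟨ *-congˡ (*-congʳ u*x≈y⁻¹) ⟩
    z * (y ⁻¹ * w)       ≈⟨ *-assoc _ _ _ ⟨
    z / y * w            ∎
    where
    u = (x * y) ⁻¹
    u*x≈y⁻¹ : u * x ≈ y ⁻¹
    u*x≈y⁻¹ = begin
      u * x                 ≈⟨ *-identityʳ _ ⟨
      u * x * 1#            ≈⟨ *-congˡ (inverse y y≉0) ⟨
      u * x * (y * y ⁻¹)    ≈⟨ *-assoc _ _ _ ⟩
      u * (x * (y * y ⁻¹))  ≈⟨ *-congˡ (*-assoc _ _ _) ⟨
      u * (x * y * y ⁻¹)    ≈⟨ *-assoc _ _ _ ⟨
      u * (x * y) * y ⁻¹    ≈⟨ *-congʳ (trans (*-comm _ _) (inverse (x * y) (x≉0∧y≉0⇒x*y≉0 x≉0 y≉0))) ⟩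
      1# * y ⁻¹             ≈⟨ *-identityˡ _ ⟩
      y ⁻¹                  ∎

  module PolyCauchy (k : ℕ) (a q : Carrier) (L : Vec Carrier k) (la : Carrier) where
    l : Carrier
    l = prodVec L

    polyCauchy-stirlingTransform : ∀ n →
      polyCauchy k a q L la n ≈ stirlingTransform q n (λ i → la * pow l i / pow (a + nat i) k)
    polyCauchy-stirlingTransform n = sumTo-cong n (λ i _ → *-assoc _ _ _)

    mPolyCauchy-stirlingTransform : ∀ n m →
      mPolyCauchy k a q L la n m
        ≈ pow (a + nat m) k / pow a k
          * stirlingTransform q n (λ i → la * pow l i / pow (a + nat (i ℕ.+ m)) k)
    mPolyCauchy-stirlingTransform n m = *-congˡ (sumTo-cong n (λ i _ → *-assoc _ _ _))

    weight-shift : ∀ m i →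
      la * pow l (m ℕ.+ i) / pow (a + nat (m ℕ.+ i)) k
        ≈ pow l m * (la * pow l i / pow (a + nat (i ℕ.+ m)) k)
    weight-shift m i = begin
      la * pow l (m ℕ.+ i) / pow (a + nat (m ℕ.+ i)) k
        ≈⟨ *-congʳ (*-congˡ (pow-+ l m i)) ⟩
      la * (pow l m * pow l i) / pow (a + nat (m ℕ.+ i)) k
        ≈⟨ *-congʳ (Multiplicative.x∙yz≈y∙xz la _ _) ⟩
      pow l m * (la * pow l i) / pow (a + nat (m ℕ.+ i)) k
        ≡⟨ ≡.cong (λ t → pow l m * (la * pow l i) / pow (a + nat t) k) (ℕP.+-comm m i) ⟩
      pow l m * (la * pow l i) / pow (a + nat (i ℕ.+ m)) k
        ≈⟨ *-assoc _ _ _ ⟩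
      pow l m * (la * pow l i / pow (a + nat (i ℕ.+ m)) k) ∎

    mPolyCauchy-rStirling2 : ¬ (a ≈ 0#) → (∀ i → ¬ (lookup L i ≈ 0#)) → ∀ n m →
      mPolyCauchy k a q L la n m
        ≈ pow (a + nat m) k / (pow l m * pow a k)
          * sumTo m (λ j → nat (rStirling2 n m j) * pow q (m ℕ.∸ j) * polyCauchy k a q L la (n ℕ.+ j))
    mPolyCauchy-rStirling2 a≉0 L≉0 n m = sym (begin
      A / (pow l m * pow a k) * sumTo m (λ j → nat (S j) * pow q (m ℕ.∸ j) * polyCauchy k a q L la (n ℕ.+ j))
        ≈⟨ *-congˡ (sumTo-cong m (λ j _ → *-congˡ (polyCauchy-stirlingTransform (n ℕ.+ j)))) ⟩
      A / (pow l m * pow a k) * sumTo m (λ j → nat (S j) * pow q (m ℕ.∸ j) * stirlingTransform q (n ℕ.+ j) w)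
        ≈⟨ *-congˡ (stirlingTransform-rStirling2 q n m w) ⟩
      A / (pow l m * pow a k) * stirlingTransform q n (λ i → w (m ℕ.+ i))
        ≈⟨ *-congˡ (trans (stirlingTransform-cong q n (weight-shift m)) (stirlingTransform-*ˡ q n _ wₘ)) ⟩
      A / (pow l m * pow a k) * (pow l m * stirlingTransform q n wₘ)
        ≈⟨ /-*-cancelˡ A _ (pow≉0 (prodVec≉0 L L≉0) m) (pow≉0 a≉0 k) ⟩
      A / pow a k * stirlingTransform q n wₘ
        ≈⟨ mPolyCauchy-stirlingTransform n m ⟨
      mPolyCauchy k a q L la n m ∎)
      where
      A = pow (a + nat m) k
      S = rStirling2 n m
      w wₘ : ℕ → Carrier
      w i  = la * pow l i / pow (a + nat i) k
      wₘ i = la * pow l i / pow (a + nat (i ℕ.+ m)) k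

    mPolyCauchy-zero : ¬ (a ≈ 0#) → ∀ n → mPolyCauchy k a q L la n 0 ≈ polyCauchy k a q L la n
    mPolyCauchy-zero a≉0 n = begin
      pow (a + 0#) k / pow a k * Y  ≈⟨ *-congʳ (*-congʳ (pow-congˡ k (+-identityʳ a))) ⟩
      pow a k / pow a k * Y         ≈⟨ *-congʳ (inverse (pow a k) (pow≉0 a≉0 k)) ⟩
      1# * Y                        ≈⟨ *-identityˡ Y ⟩
      Y                             ≈⟨ sumTo-cong n (λ i _ → reflexive (≡.cong (term i) (ℕP.+-identityʳ i))) ⟩
      polyCauchy k a q L la n       ∎
      where
      term : ℕ → ℕ → Carrier
      term i t = int (stirling1 n i) * pow q (n ℕ.∸ i) * (la * pow l i) / pow (a + nat t) k
      Y : Carrier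
      Y = sumTo n (λ i → term i (i ℕ.+ 0))

theorem1 : ∀ {c ℓ} (F : Field c ℓ) → let open FieldOps F in
    (k : ℕ) → 1 ≤ k →
    (a q : Carrier) (L : Vec Carrier k) (la : Carrier) →
    ¬ (a ≈ 0#) → ¬ (q ≈ 0#) → (∀ (i : Fin k) → ¬ (lookup L i ≈ 0#)) → ¬ (la ≈ 0#) →
    (∀ (j : ℕ) → ¬ (a + nat j ≈ 0#)) →
    (n m : ℕ) →
    (mPolyCauchy k a q L la n m
       ≈ pow (a + nat m) k / (pow (prodVec L) m * pow a k)
         * sumTo m (λ j → nat (rStirling2 n m j) * pow q (m ℕ.∸ j) * polyCauchy k a q L la (n ℕ.+ j)))
    × (mPolyCauchy k a q L la n 0 ≈ polyCauchy k a q L la n)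
theorem1 F k _ a q L la a≉0 _ L≉0 _ _ n m =
  mPolyCauchy-rStirling2 a≉0 L≉0 n m , mPolyCauchy-zero a≉0 n
  where open FieldProperties.PolyCauchy F k a q L la
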